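{- For all $m\ge1$ and $N=2^m+1$, for every $i=1,\dots,|\mathcal{A}_m|$ the prefixes of length $N$ of $w^{m+1}_{2i-1}$ and of $w^{m+1}_{2i}$ are both equal to $w^m_i$.
   Context: For $m\ge1$, $\mathcal{A}_m$ is the set of subwords of length $2^m+1$ of the Thue-Morse sequence $0110100110010110\dots$ (the fixed point of $\theta(0)=01$, $\theta(1)=10$), listed in lexicographic order (with $0<1$) as $w^m_1<w^m_2<\dots<w^m_{|\mathcal{A}_m|}$. -}

module Defs where

open import Data.Nat using (ℕ; zero; suc; _+_; _^_)
open import Data.Bool using (Bool; true; false) renaming (_<_ to _<ᵇ_)
open import Data.List using (List; []; _∷_; _++_; concatMap; take; drop; length)
open import Data.Maybe using (Maybe; just; nothing)
open import Data.Product using (∃-syntax)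
open import Relation.Binary.PropositionalEquality using (_≡_)
open import Data.List.Relation.Binary.Lex.Strict using (Lex-<)
open import Data.List.Relation.Unary.Linked using (Linked)
open import Data.List.Membership.Propositional using (_∈_)
open import Function.Bundles using (_⇔_)

-- Letters: 0 = false, 1 = true (so 0 < 1 is false <ᵇ true).
Word : Set
Word = List Bool

θ : Bool → Word
θ false = false ∷ true ∷ []
θ true  = true ∷ false ∷ []

tmPrefix : ℕ → Word
tmPrefix zero    = false ∷ []
tmPrefix (suc k) = concatMap θ (tmPrefix k)

IsFactor : Word → Set
IsFactor w = ∃[ k ] ∃[ j ] (take (length w) (drop j (tmPrefix k)) ≡ w)

InA : ℕ → Word → Set
InA m w = length w ≡ 2 ^ m + 1 × IsFactor w
  where open import Data.Product using (_×_)

_<ₗ_ : Word → Word → Set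
_<ₗ_ = Lex-< _≡_ _<ᵇ_

-- L lists A_m in increasing lexicographic order: w^m_1 < w^m_2 < ...
-- (L is strictly increasing and its elements are exactly those of A_m).
Enumerates : ℕ → List Word → Set
Enumerates m L = Linked _<ₗ_ L × (∀ w → (w ∈ L) ⇔ InA m w)
  where open import Data.Product using (_×_)

-- 0-indexed lookup.
nth : {A : Set} → List A → ℕ → Maybe A
nth []       _       = nothing
nth (x ∷ xs) zero    = just x
nth (x ∷ xs) (suc i) = nth xs i

module Submission where

-- Let F(ℓ) be the set of factors of length ℓ of the Thue–Morse word.  Writing Θ
-- for θ applied letterwise, a factor of odd length 2n+1 ≥ 3 is Θ₀ n v (the
-- prefix of Θ v of that length) or Θ₁ v (Θ v minus its first letter) for some
-- v ∈ F(n+1): this is desubstitution.  With it we show that for N = 2^m, m ≥ 1,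
-- every u ∈ F(N+1) is the prefix of exactly two words of F(2N+1): for m = 1 by
-- a finite computation, and in the step N → 2N by writing u = Θ₀ v or Θ₁ v and
-- applying the same map to the two extensions of v; an extension of the other
-- shape would make a cube bbb a factor, which is impossible.  Finally, replacing
-- each word of the sorted list of F(N+1) by its two extensions gives a strictly
-- sorted list with exactly the elements of F(2N+1).  Such a list is unique, so
-- it is the sorted enumeration, and its entries 2i and 2i+1 extend entry i.

open import Defs
open import Data.Bool using (Bool; true; false; not)
import Data.Bool.Properties as Bool
open import Data.Bool.Properties using (not-injective; not-involutive)
open import Data.Empty using (⊥-elim)
open import Data.List using (List; []; _∷_; concatMap; take; drop; length)
open import Data.List.Properties using (≡-dec; ∷-injective; drop-drop; take-take; length-take; take-all)
open import Data.List.Membership.Propositional using (_∈_)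
open import Data.List.Membership.DecPropositional (≡-dec Bool._≟_) using (_∈?_)
open import Data.List.Relation.Binary.Lex.Strict using (halt; this; next; base; <-strictPartialOrder; <-decidable)
import Data.List.Relation.Binary.Pointwise as Pointwise
open import Data.List.Relation.Unary.All as All using (All; all?; []; _∷_)
import Data.List.Relation.Unary.AllPairs as AllPairs
open import Data.List.Relation.Unary.Any using (here; there)
open import Data.List.Relation.Unary.Linked as Linked using (Linked; []; [-]; _∷_)
open import Data.List.Relation.Unary.Linked.Properties using (Linked⇒AllPairs)
open import Data.Maybe using (just; map)
open import Data.Nat using (ℕ; zero; suc; _+_; _*_; _^_; _≤_; _<_; z≤n; s≤s)
open import Data.Nat.Properties
  using (module ≤-Reasoning; *-suc; +-comm; *-cancelˡ-≡; *-monoʳ-≤; +-monoˡ-≤; suc-injective;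
         n≤1+n; m≤m+n; ≤-refl; ≤-trans; ≤-reflexive; ≤-antisym; m⊓n≤m; m≤n⇒m⊓n≡m; m^n>0)
open import Data.Product using (Σ; _×_; _,_; proj₁; proj₂)
open import Data.Sum using (_⊎_; inj₁; inj₂)
open import Function.Bundles using (_⇔_; Equivalence)
open import Relation.Binary.Bundles using (StrictPartialOrder)
open import Relation.Binary.Definitions using (Transitive)
open import Relation.Binary.PropositionalEquality
open import Relation.Nullary using (¬_)
open import Relation.Nullary.Decidable using (True; toWitness; toWitnessFalse; _×-dec_; _⊎-dec_)

-- Rewrites 2 * (r + 1) into the form on which take, drop and nth compute.
at-double-suc : ∀ {A : Set} (f : ℕ → A) r → f (2 * suc r) ≡ f (suc (suc (2 * r)))
at-double-suc f r = cong f (*-suc 2 r)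

N≤2N : ∀ N → N ≤ 2 * N
N≤2N N = m≤m+n N (N + 0)

take-take-≤ : ∀ {A : Set} r s (xs : List A) → r ≤ s → take r (take s xs) ≡ take r xs
take-take-≤ r s xs r≤s = trans (take-take r s xs) (cong (λ n → take n xs) (m≤n⇒m⊓n≡m r≤s))

take-agree-≤ : ∀ {A : Set} r s (x y : List A) → r ≤ s → take s x ≡ take s y → take r x ≡ take r y
take-agree-≤ r s x y r≤s e =
  trans (sym (take-take-≤ r s x r≤s)) (trans (cong (take r) e) (take-take-≤ r s y r≤s))

length-take-≤ : ∀ {A : Set} r (xs : List A) → length (take r xs) ≤ r
length-take-≤ r xs = ≤-trans (≤-reflexive (length-take r xs)) (m⊓n≤m r (length xs))

length-take-≥ : ∀ {A : Set} r (xs : List A) → r ≤ length xs → length (take r xs) ≡ r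
length-take-≥ r xs r≤ = trans (length-take r xs) (m≤n⇒m⊓n≡m r≤)

prefix-take : ∀ {A : Set} r (w d : List A) → take (length w) d ≡ w → take (length (take r w)) d ≡ take r w
prefix-take zero    w       d       e = refl
prefix-take (suc r) []      d       e = refl
prefix-take (suc r) (x ∷ w) (y ∷ d) e with ∷-injective e
... | refl , e′ = cong (x ∷_) (prefix-take r w d e′)

prefix-drop : ∀ {A : Set} r (w d : List A) → take (length w) d ≡ w →
              take (length (drop r w)) (drop r d) ≡ drop r w
prefix-drop zero    w       d       e = e
prefix-drop (suc r) []      d       e = refl
prefix-drop (suc r) (x ∷ w) (y ∷ d) e = prefix-drop r w d (proj₂ (∷-injective e))

Θ : Word → Word
Θ []       = []
Θ (x ∷ xs) = x ∷ not x ∷ Θ xs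

concatMap-θ : ∀ w → concatMap θ w ≡ Θ w
concatMap-θ []          = refl
concatMap-θ (false ∷ w) = cong (λ z → false ∷ true ∷ z) (concatMap-θ w)
concatMap-θ (true ∷ w)  = cong (λ z → true ∷ false ∷ z) (concatMap-θ w)

tmPrefix-suc : ∀ k → tmPrefix (suc k) ≡ Θ (tmPrefix k)
tmPrefix-suc k = concatMap-θ (tmPrefix k)

length-Θ : ∀ w → length (Θ w) ≡ 2 * length w
length-Θ []      = refl
length-Θ (x ∷ w) = trans (cong (λ n → suc (suc n)) (length-Θ w)) (sym (*-suc 2 (length w)))

take-Θ : ∀ r w → take (2 * r) (Θ w) ≡ Θ (take r w)
take-Θ zero    w       = refl
take-Θ (suc r) []      = refl
take-Θ (suc r) (x ∷ w) = trans (at-double-suc (λ n → take n (Θ (x ∷ w))) r)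
                               (cong (λ z → x ∷ not x ∷ z) (take-Θ r w))

drop-Θ : ∀ r w → drop (2 * r) (Θ w) ≡ Θ (drop r w)
drop-Θ zero    w       = refl
drop-Θ (suc r) []      = refl
drop-Θ (suc r) (x ∷ w) = trans (at-double-suc (λ n → drop n (Θ (x ∷ w))) r) (drop-Θ r w)

Θ-injective : ∀ x y → Θ x ≡ Θ y → x ≡ y
Θ-injective []       []       _ = refl
Θ-injective (x ∷ xs) (y ∷ ys) e with ∷-injective e
... | x≡y , e′ = cong₂ _∷_ x≡y (Θ-injective xs ys (proj₂ (∷-injective e′)))

IsFactor-take : ∀ r w → IsFactor w → IsFactor (take r w)
IsFactor-take r w (k , j , e) = k , j , prefix-take r w (drop j (tmPrefix k)) e

IsFactor-drop : ∀ r w → IsFactor w → IsFactor (drop r w)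
IsFactor-drop r w (k , j , e) =
  k , j + r , subst (λ d → take (length (drop r w)) d ≡ drop r w)
                    (drop-drop j r (tmPrefix k)) (prefix-drop r w (drop j (tmPrefix k)) e)

IsFactor-Θ : ∀ w → IsFactor w → IsFactor (Θ w)
IsFactor-Θ w (k , j , e) = suc k , 2 * j , (begin
    take (length (Θ w)) (drop (2 * j) (tmPrefix (suc k)))
      ≡⟨ cong₂ (λ n t → take n (drop (2 * j) t)) (length-Θ w) (tmPrefix-suc k) ⟩
    take (2 * length w) (drop (2 * j) (Θ (tmPrefix k)))
      ≡⟨ cong (take (2 * length w)) (drop-Θ j (tmPrefix k)) ⟩
    take (2 * length w) (Θ (drop j (tmPrefix k)))
      ≡⟨ take-Θ (length w) (drop j (tmPrefix k)) ⟩
    Θ (take (length w) (drop j (tmPrefix k)))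
      ≡⟨ cong Θ e ⟩
    Θ w ∎)
  where open ≡-Reasoning

Factor : ℕ → Word → Set
Factor ℓ w = length w ≡ ℓ × IsFactor w

Factor-take : ∀ r ℓ w → r ≤ ℓ → Factor ℓ w → Factor r (take r w)
Factor-take r ℓ w r≤ℓ (len , fac) =
  length-take-≥ r w (≤-trans r≤ℓ (≤-reflexive (sym len))) , IsFactor-take r w fac

-- A word of odd length 2n+1 sits inside Θ v either at an even position, like
-- Θ₀ n v (the prefix of length 2n+1), or at an odd one, like Θ₁ v (Θ v
-- without its first letter).
Θ₀ : ℕ → Word → Word
Θ₀ n v = take (suc (2 * n)) (Θ v)

Θ₁ : Word → Word
Θ₁ v = drop 1 (Θ v)

Θ₀-cons : ∀ n x v → Θ₀ (suc n) (x ∷ v) ≡ x ∷ not x ∷ Θ₀ n v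
Θ₀-cons n x v = at-double-suc (λ m → take (suc m) (Θ (x ∷ v))) n

Θ₀-take : ∀ n v → Θ₀ n (take (suc n) v) ≡ Θ₀ n v
Θ₀-take n       []      = refl
Θ₀-take zero    (x ∷ v) = refl
Θ₀-take (suc n) (x ∷ v) = begin
    Θ₀ (suc n) (x ∷ take (suc n) v)   ≡⟨ Θ₀-cons n x (take (suc n) v) ⟩
    x ∷ not x ∷ Θ₀ n (take (suc n) v) ≡⟨ cong (λ z → x ∷ not x ∷ z) (Θ₀-take n v) ⟩
    x ∷ not x ∷ Θ₀ n v                ≡⟨ sym (Θ₀-cons n x v) ⟩
    Θ₀ (suc n) (x ∷ v)                ∎
  where open ≡-Reasoning

take-Θ₀ : ∀ m n x → m ≤ n → take (suc (2 * m)) (Θ₀ n x) ≡ Θ₀ m (take (suc m) x)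
take-Θ₀ m n x m≤n = trans (take-take-≤ (suc (2 * m)) (suc (2 * n)) (Θ x) (s≤s (*-monoʳ-≤ 2 m≤n)))
                          (sym (Θ₀-take m x))

Θ₁-take : ∀ n v → Θ₁ (take (suc n) v) ≡ take (suc (2 * n)) (Θ₁ v)
Θ₁-take n []      = refl
Θ₁-take n (x ∷ v) = cong (not x ∷_) (sym (take-Θ n v))

drop-odd-Θ : ∀ q w → drop (suc (2 * q)) (Θ w) ≡ Θ₁ (drop q w)
drop-odd-Θ q w = begin
  drop (suc (2 * q)) (Θ w)    ≡⟨ cong (λ i → drop i (Θ w)) (+-comm 1 (2 * q)) ⟩
  drop (2 * q + 1) (Θ w)      ≡⟨ sym (drop-drop (2 * q) 1 (Θ w)) ⟩
  drop 1 (drop (2 * q) (Θ w)) ≡⟨ cong (drop 1) (drop-Θ q w) ⟩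
  Θ₁ (drop q w)               ∎
  where open ≡-Reasoning

length-Θ₀ : ∀ n v → length v ≡ suc n → length (Θ₀ n v) ≡ suc (2 * n)
length-Θ₀ n v len = length-take-≥ (suc (2 * n)) (Θ v) (begin
  suc (2 * n)       ≤⟨ n≤1+n (suc (2 * n)) ⟩
  suc (suc (2 * n)) ≡⟨ sym (*-suc 2 n) ⟩
  2 * suc n         ≡⟨ cong (2 *_) (sym len) ⟩
  2 * length v      ≡⟨ sym (length-Θ v) ⟩
  length (Θ v)      ∎)
  where open ≤-Reasoning

length-Θ₁ : ∀ n v → length v ≡ suc n → length (Θ₁ v) ≡ suc (2 * n)
length-Θ₁ n (x ∷ v) len = cong suc (trans (length-Θ v) (cong (2 *_) (suc-injective len)))

length-Θ₀⁻ : ∀ n v → length (Θ₀ n v) ≡ suc (2 * n) → suc n ≤ length v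
length-Θ₀⁻ zero    (x ∷ v) len = s≤s z≤n
length-Θ₀⁻ (suc n) (x ∷ v) len = s≤s (length-Θ₀⁻ n v (suc-injective (suc-injective (begin
  suc (suc (length (Θ₀ n v))) ≡⟨ cong length (sym (Θ₀-cons n x v)) ⟩
  length (Θ₀ (suc n) (x ∷ v)) ≡⟨ len ⟩
  suc (2 * suc n)             ≡⟨ cong suc (*-suc 2 n) ⟩
  suc (suc (suc (2 * n)))     ∎))))
  where open ≡-Reasoning

length-Θ₁⁻ : ∀ n v → length (Θ₁ v) ≡ suc (2 * n) → length v ≡ suc n
length-Θ₁⁻ n (x ∷ v) len =
  cong suc (*-cancelˡ-≡ (length v) n 2 (trans (sym (length-Θ v)) (suc-injective len)))

Factor-Θ₀ : ∀ n v → Factor (suc n) v → Factor (suc (2 * n)) (Θ₀ n v)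
Factor-Θ₀ n v (len , fac) = length-Θ₀ n v len , IsFactor-take _ (Θ v) (IsFactor-Θ v fac)

Factor-Θ₁ : ∀ n v → Factor (suc n) v → Factor (suc (2 * n)) (Θ₁ v)
Factor-Θ₁ n v (len , fac) = length-Θ₁ n v len , IsFactor-drop 1 (Θ v) (IsFactor-Θ v fac)

data Parity : ℕ → Set where
  even : ∀ q → Parity (2 * q)
  odd  : ∀ q → Parity (suc (2 * q))

parity : ∀ j → Parity j
parity zero          = even 0
parity (suc zero)    = odd 0
parity (suc (suc j)) with parity j
... | even q = subst Parity (*-suc 2 q) (even (suc q))
... | odd q  = subst Parity (cong suc (*-suc 2 q)) (odd (suc q))

even-occurrence : ∀ n k q → take (suc (2 * n)) (drop (2 * q) (tmPrefix (suc k)))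
                            ≡ Θ₀ n (take (suc n) (drop q (tmPrefix k)))
even-occurrence n k q = begin
  take (suc (2 * n)) (drop (2 * q) (tmPrefix (suc k)))
    ≡⟨ cong (λ t → take (suc (2 * n)) (drop (2 * q) t)) (tmPrefix-suc k) ⟩
  take (suc (2 * n)) (drop (2 * q) (Θ (tmPrefix k)))
    ≡⟨ cong (take (suc (2 * n))) (drop-Θ q (tmPrefix k)) ⟩
  Θ₀ n (drop q (tmPrefix k))
    ≡⟨ sym (Θ₀-take n (drop q (tmPrefix k))) ⟩
  Θ₀ n (take (suc n) (drop q (tmPrefix k))) ∎
  where open ≡-Reasoning

odd-occurrence : ∀ n k q → take (suc (2 * n)) (drop (suc (2 * q)) (tmPrefix (suc k)))
                           ≡ Θ₁ (take (suc n) (drop q (tmPrefix k)))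
odd-occurrence n k q = begin
  take (suc (2 * n)) (drop (suc (2 * q)) (tmPrefix (suc k)))
    ≡⟨ cong (λ t → take (suc (2 * n)) (drop (suc (2 * q)) t)) (tmPrefix-suc k) ⟩
  take (suc (2 * n)) (drop (suc (2 * q)) (Θ (tmPrefix k)))
    ≡⟨ cong (take (suc (2 * n))) (drop-odd-Θ q (tmPrefix k)) ⟩
  take (suc (2 * n)) (Θ₁ (drop q (tmPrefix k)))
    ≡⟨ sym (Θ₁-take n (drop q (tmPrefix k))) ⟩
  Θ₁ (take (suc n) (drop q (tmPrefix k))) ∎
  where open ≡-Reasoning

Desubstitution : ℕ → Word → Set
Desubstitution n w = Σ Word λ v → Factor (suc n) v × (w ≡ Θ₀ n v ⊎ w ≡ Θ₁ v)

-- An occurrence of w at position j of θ^(k+1)(0) is pulled back to θ^k(0)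
-- according to the parity of j; n ≥ 1 rules out the occurrences in θ⁰(0) = 0.
desubstitute : ∀ n w → 1 ≤ n → Factor (suc (2 * n)) w → Desubstitution n w
desubstitute n@(suc _) w _ (len , k , j , e) =
  from-occurrence k j (subst (λ ℓ → take ℓ (drop j (tmPrefix k)) ≡ w) len e)
  where
  L : ℕ
  L = suc (2 * n)
  ancestor : ℕ → ℕ → Word
  ancestor k q = take (suc n) (drop q (tmPrefix k))
  ancestor-IsFactor : ∀ k q → IsFactor (ancestor k q)
  ancestor-IsFactor k q = IsFactor-take (suc n) _ (k , q , take-all _ _ ≤-refl)
  too-long : ∀ j → length (take L (drop j (tmPrefix 0))) ≢ L
  too-long zero          ()
  too-long (suc zero)    ()
  too-long (suc (suc j)) ()
  from-occurrence : ∀ k j → take L (drop j (tmPrefix k)) ≡ w → Desubstitution n w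
  from-occurrence zero    j occ = ⊥-elim (too-long j (trans (cong length occ) len))
  from-occurrence (suc k) j occ with parity j
  ... | even q = ancestor k q , (length-ancestor , ancestor-IsFactor k q) , inj₁ w≡
    where
    w≡ : w ≡ Θ₀ n (ancestor k q)
    w≡ = trans (sym occ) (even-occurrence n k q)
    length-ancestor : length (ancestor k q) ≡ suc n
    length-ancestor = ≤-antisym (length-take-≤ (suc n) (drop q (tmPrefix k)))
                                (length-Θ₀⁻ n (ancestor k q) (trans (cong length (sym w≡)) len))
  ... | odd q = ancestor k q , (length-ancestor , ancestor-IsFactor k q) , inj₂ w≡
    where
    w≡ : w ≡ Θ₁ (ancestor k q)
    w≡ = trans (sym occ) (odd-occurrence n k q)
    length-ancestor : length (ancestor k q) ≡ suc n
    length-ancestor = length-Θ₁⁻ n (ancestor k q) (trans (cong length (sym w≡)) len)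

<ₗ-irrefl : ∀ {x} → ¬ x <ₗ x
<ₗ-irrefl = StrictPartialOrder.irrefl (<-strictPartialOrder Bool.<-strictPartialOrder) (Pointwise.refl refl)

<ₗ-trans : Transitive _<ₗ_
<ₗ-trans = StrictPartialOrder.trans (<-strictPartialOrder Bool.<-strictPartialOrder)

<ₗ-from-prefix : ∀ r x y → take r x <ₗ take r y → x <ₗ y
<ₗ-from-prefix zero    x        y        (base ())
<ₗ-from-prefix (suc r) []       []       (base ())
<ₗ-from-prefix (suc r) []       (y ∷ ys) _            = halt
<ₗ-from-prefix (suc r) (x ∷ xs) (y ∷ ys) (this x<y)   = this x<y
<ₗ-from-prefix (suc r) (x ∷ xs) (y ∷ ys) (next x≡y p) = next x≡y (<ₗ-from-prefix r xs ys p)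

-- Θ, Θ₀ and Θ₁ are strictly monotone (Θ₁ only on words with the same first
-- letter, since it forgets that letter).
Θ-mono : ∀ {a b} → a <ₗ b → Θ a <ₗ Θ b
Θ-mono halt          = halt
Θ-mono (this x<y)    = this x<y
Θ-mono (next refl p) = next refl (next refl (Θ-mono p))

Θ₀-mono : ∀ n {a b} → length a ≡ suc n → length b ≡ suc n → a <ₗ b → Θ₀ n a <ₗ Θ₀ n b
Θ₀-mono n       () lb halt
Θ₀-mono zero    la lb (this x<y) = this x<y
Θ₀-mono (suc n) la lb (this x<y) = this x<y
Θ₀-mono zero    {_ ∷ []} {_ ∷ []} la lb (next refl (base ()))
Θ₀-mono (suc n) {x ∷ as} {_ ∷ bs} la lb (next refl p) =
  subst₂ _<ₗ_ (sym (Θ₀-cons n x as)) (sym (Θ₀-cons n x bs))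
    (next refl (next refl (Θ₀-mono n (suc-injective la) (suc-injective lb) p)))

Θ₁-mono : ∀ {a b} → take 1 a ≡ take 1 b → a <ₗ b → Θ₁ a <ₗ Θ₁ b
Θ₁-mono refl (this x<x)    = ⊥-elim (Bool.<-irrefl refl x<x)
Θ₁-mono _    (next refl p) = next refl (Θ-mono p)

Θ₀-injective : ∀ n x y → length x ≡ suc n → length y ≡ suc n → Θ₀ n x ≡ Θ₀ n y → x ≡ y
Θ₀-injective zero    (x ∷ []) (y ∷ []) _ _ e = cong (_∷ []) (proj₁ (∷-injective e))
Θ₀-injective (suc n) (x ∷ xs) (y ∷ ys) lx ly e
  with ∷-injective (trans (sym (Θ₀-cons n x xs)) (trans e (Θ₀-cons n y ys)))
... | x≡y , e′ = cong₂ _∷_ x≡y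
  (Θ₀-injective n xs ys (suc-injective lx) (suc-injective ly) (proj₂ (∷-injective e′)))

Θ₁-injective : ∀ x y → Θ₁ x ≡ Θ₁ y → x ≡ y
Θ₁-injective []       []       _ = refl
Θ₁-injective (x ∷ xs) (y ∷ ys) e with ∷-injective e
... | x̄≡ȳ , e′ = cong₂ _∷_ (not-injective x̄≡ȳ) (Θ-injective xs ys e′)

-- Even and odd occurrences cannot be confused: if Θ₁ y = Θ₀ N x with N ≥ 2
-- then ȳ₀ y₁ ȳ₁ y₂ = x₀ x̄₀ x₁ x̄₁, so y begins with a cube y₀y₀y₀.
collision-cube : ∀ n x₀ x₁ xs y → Θ₁ y ≡ Θ₀ (suc (suc n)) (x₀ ∷ x₁ ∷ xs) →
                 Σ Bool λ b → take 3 y ≡ b ∷ b ∷ b ∷ []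
collision-cube n x₀ x₁ xs y e = cube y (trans e (trans (Θ₀-cons (suc n) x₀ (x₁ ∷ xs))
                                                       (cong (λ z → x₀ ∷ not x₀ ∷ z) (Θ₀-cons n x₁ xs))))
  where
  not-not : ∀ {a b c} → not a ≡ b → c ≡ not b → c ≡ a
  not-not {a} refl refl = not-involutive a
  cube : ∀ y → Θ₁ y ≡ x₀ ∷ not x₀ ∷ x₁ ∷ not x₁ ∷ Θ₀ n xs → Σ Bool λ b → take 3 y ≡ b ∷ b ∷ b ∷ []
  cube (y₀ ∷ y₁ ∷ y₂ ∷ ys) e with ∷-injective e
  ... | e₀ , e′ with ∷-injective e′
  ... | e₁ , e″ with ∷-injective e″
  ... | e₂ , e‴ with ∷-injective e‴
  ... | e₃ , _ = y₀ , cong₂ (λ p q → y₀ ∷ p ∷ q ∷ []) y₁≡y₀ (trans y₂≡y₁ y₁≡y₀)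
    where
    y₁≡y₀ : y₁ ≡ y₀
    y₁≡y₀ = not-not e₀ e₁
    y₂≡y₁ : y₂ ≡ y₁
    y₂≡y₁ = not-not e₂ e₃

pattern O = false
pattern I = true

A₃ : List Word
A₃ = (O ∷ O ∷ I ∷ []) ∷ (O ∷ I ∷ O ∷ []) ∷ (O ∷ I ∷ I ∷ []) ∷
     (I ∷ O ∷ O ∷ []) ∷ (I ∷ O ∷ I ∷ []) ∷ (I ∷ I ∷ O ∷ []) ∷ []

A₅ : List Word
A₅ = (O ∷ O ∷ I ∷ O ∷ I ∷ []) ∷ (O ∷ O ∷ I ∷ I ∷ O ∷ []) ∷ (O ∷ I ∷ O ∷ O ∷ I ∷ []) ∷ (O ∷ I ∷ O ∷ I ∷ I ∷ []) ∷
     (O ∷ I ∷ I ∷ O ∷ O ∷ []) ∷ (O ∷ I ∷ I ∷ O ∷ I ∷ []) ∷ (I ∷ O ∷ O ∷ I ∷ O ∷ []) ∷ (I ∷ O ∷ O ∷ I ∷ I ∷ []) ∷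
     (I ∷ O ∷ I ∷ O ∷ O ∷ []) ∷ (I ∷ O ∷ I ∷ I ∷ O ∷ []) ∷ (I ∷ I ∷ O ∷ O ∷ I ∷ []) ∷ (I ∷ I ∷ O ∷ I ∷ O ∷ []) ∷ []

-- Each word of A₅ occurs in θ⁴(0) = 0110100110010110 at the given position.
A₅-factors : All (Factor 5) A₅
A₅-factors = (refl , 4 , 9 , refl) ∷ (refl , 4 , 5 , refl) ∷ (refl , 4 , 3 , refl) ∷ (refl , 4 , 10 , refl) ∷
             (refl , 4 , 6 , refl) ∷ (refl , 4 , 0 , refl) ∷ (refl , 4 , 8 , refl) ∷ (refl , 4 , 4 , refl) ∷
             (refl , 4 , 2 , refl) ∷ (refl , 4 , 11 , refl) ∷ (refl , 4 , 7 , refl) ∷ (refl , 4 , 1 , refl) ∷ []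

decide : ∀ {w L} {checked : True (w ∈? L)} → w ∈ L
decide {checked = checked} = toWitness checked

Θ-images-in-A₃ : ∀ a b → Θ₀ 1 (a ∷ b ∷ []) ∈ A₃ × Θ₁ (a ∷ b ∷ []) ∈ A₃
Θ-images-in-A₃ O O = decide , decide
Θ-images-in-A₃ O I = decide , decide
Θ-images-in-A₃ I O = decide , decide
Θ-images-in-A₃ I I = decide , decide

-- Desubstitution reduces the completeness of A₃ and A₅ to finitely many cases.
A₃-complete : ∀ u → Factor 3 u → u ∈ A₃
A₃-complete u fu with desubstitute 1 u (s≤s z≤n) fu
... | a ∷ b ∷ []    , _        , inj₁ refl = proj₁ (Θ-images-in-A₃ a b)
... | a ∷ b ∷ []    , _        , inj₂ refl = proj₂ (Θ-images-in-A₃ a b)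
... | []            , (() , _) , _
... | _ ∷ []        , (() , _) , _
... | _ ∷ _ ∷ _ ∷ _ , (() , _) , _

Θ-images-in-A₅ : All (λ v → Θ₀ 2 v ∈ A₅ × Θ₁ v ∈ A₅) A₃
Θ-images-in-A₅ = toWitness {a? = all? (λ v → Θ₀ 2 v ∈? A₅ ×-dec Θ₁ v ∈? A₅) A₃} _

A₅-complete : ∀ w → Factor 5 w → w ∈ A₅
A₅-complete w fw with desubstitute 2 w (s≤s z≤n) fw
... | v , fv , inj₁ refl = proj₁ (All.lookup Θ-images-in-A₅ (A₃-complete v fv))
... | v , fv , inj₂ refl = proj₂ (All.lookup Θ-images-in-A₅ (A₃-complete v fv))

no-cube : ∀ b → ¬ IsFactor (b ∷ b ∷ b ∷ [])
no-cube O fac = toWitnessFalse {a? = (O ∷ O ∷ O ∷ []) ∈? A₃} _ (A₃-complete _ (refl , fac))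
no-cube I fac = toWitnessFalse {a? = (I ∷ I ∷ I ∷ []) ∈? A₃} _ (A₃-complete _ (refl , fac))

no-collision : ∀ n x y → 2 ≤ length x → IsFactor y → Θ₁ y ≢ Θ₀ (suc (suc n)) x
no-collision n (_ ∷ [])       y (s≤s ()) fy e
no-collision n (x₀ ∷ x₁ ∷ xs) y _        fy e with collision-cube n x₀ x₁ xs y e
... | b , cube = no-cube b (subst IsFactor cube (IsFactor-take 3 y fy))

record Extensions (ℓ ℓ′ : ℕ) (u : Word) : Set where
  field
    lower upper  : Word
    lower<upper  : lower <ₗ upper
    lower-factor : Factor ℓ′ lower
    upper-factor : Factor ℓ′ upper
    lower-prefix : take ℓ lower ≡ u
    upper-prefix : take ℓ upper ≡ u
    exhaustive   : ∀ w → Factor ℓ′ w → take ℓ w ≡ u → w ≡ lower ⊎ w ≡ upper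

TwoExtensions : ℕ → ℕ → Set
TwoExtensions ℓ ℓ′ = ∀ u → Factor ℓ u → Extensions ℓ ℓ′ u

base-extensions : Word → Word × Word
base-extensions (O ∷ O ∷ I ∷ []) = (O ∷ O ∷ I ∷ O ∷ I ∷ []) , (O ∷ O ∷ I ∷ I ∷ O ∷ [])
base-extensions (O ∷ I ∷ O ∷ []) = (O ∷ I ∷ O ∷ O ∷ I ∷ []) , (O ∷ I ∷ O ∷ I ∷ I ∷ [])
base-extensions (O ∷ I ∷ I ∷ []) = (O ∷ I ∷ I ∷ O ∷ O ∷ []) , (O ∷ I ∷ I ∷ O ∷ I ∷ [])
base-extensions (I ∷ O ∷ O ∷ []) = (I ∷ O ∷ O ∷ I ∷ O ∷ []) , (I ∷ O ∷ O ∷ I ∷ I ∷ [])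
base-extensions (I ∷ O ∷ I ∷ []) = (I ∷ O ∷ I ∷ O ∷ O ∷ []) , (I ∷ O ∷ I ∷ I ∷ O ∷ [])
base-extensions (I ∷ I ∷ O ∷ []) = (I ∷ I ∷ O ∷ O ∷ I ∷ []) , (I ∷ I ∷ O ∷ I ∷ O ∷ [])
base-extensions _                = [] , []

BaseCheck : Word → Set
BaseCheck u = let (a , b) = base-extensions u in
  (a <ₗ b) × a ∈ A₅ × b ∈ A₅ × take 3 a ≡ u × take 3 b ≡ u

base-checks : All BaseCheck A₃
base-checks = toWitness {a? = all? (λ u → let (a , b) = base-extensions u in
    <-decidable Bool._≟_ Bool._<?_ a b ×-dec a ∈? A₅ ×-dec b ∈? A₅ ×-dec
    ≡-dec Bool._≟_ (take 3 a) u ×-dec ≡-dec Bool._≟_ (take 3 b) u) A₃} _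

base-exhaustive : All (λ w → w ≡ proj₁ (base-extensions (take 3 w)) ⊎ w ≡ proj₂ (base-extensions (take 3 w))) A₅
base-exhaustive = toWitness {a? = all? (λ w → ≡-dec Bool._≟_ w (proj₁ (base-extensions (take 3 w))) ⊎-dec
                                              ≡-dec Bool._≟_ w (proj₂ (base-extensions (take 3 w)))) A₅} _

two-extensions-3-5 : TwoExtensions 3 5
two-extensions-3-5 u fu with All.lookup base-checks (A₃-complete u fu)
... | a<b , a∈A₅ , b∈A₅ , a-prefix , b-prefix = record
  { lower        = proj₁ (base-extensions u)
  ; upper        = proj₂ (base-extensions u)
  ; lower<upper  = a<b
  ; lower-factor = All.lookup A₅-factors a∈A₅
  ; upper-factor = All.lookup A₅-factors b∈A₅
  ; lower-prefix = a-prefix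
  ; upper-prefix = b-prefix
  ; exhaustive   = λ w fw w-prefix →
      subst (λ z → w ≡ proj₁ (base-extensions z) ⊎ w ≡ proj₂ (base-extensions z)) w-prefix
            (All.lookup base-exhaustive (A₅-complete w fw))
  }

extensions-lift : ∀ {ℓ₁ ℓ₂ ℓ₃} (F G : Word → Word) {v} → ℓ₁ ≤ ℓ₂ →
  (∀ x → take ℓ₂ (G x) ≡ F (take ℓ₁ x)) →
  (∀ x → Factor ℓ₁ x → F x ≡ F v → x ≡ v) →
  (∀ x → Factor ℓ₂ x → Factor ℓ₃ (G x)) →
  (∀ a b → Factor ℓ₂ a → Factor ℓ₂ b → take ℓ₁ a ≡ take ℓ₁ b → a <ₗ b → G a <ₗ G b) →
  (∀ w → Factor ℓ₃ w → take ℓ₂ w ≡ F v → Σ Word λ x → Factor ℓ₂ x × w ≡ G x) →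
  Extensions ℓ₁ ℓ₂ v → Extensions ℓ₂ ℓ₃ (F v)
extensions-lift {ℓ₁} {ℓ₂} {ℓ₃} F G {v} ℓ₁≤ℓ₂ G-prefix F-injective G-factor G-mono G-onto ext = record
  { lower        = G lower
  ; upper        = G upper
  ; lower<upper  = G-mono lower upper lower-factor upper-factor
                          (trans lower-prefix (sym upper-prefix)) lower<upper
  ; lower-factor = G-factor lower lower-factor
  ; upper-factor = G-factor upper upper-factor
  ; lower-prefix = trans (G-prefix lower) (cong F lower-prefix)
  ; upper-prefix = trans (G-prefix upper) (cong F upper-prefix)
  ; exhaustive   = lifted-exhaustive
  }
  where
  open Extensions ext
  -- w = G x, and the prefix of x of length ℓ₁ is v, so x is lower or upper.
  lifted-exhaustive : ∀ w → Factor ℓ₃ w → take ℓ₂ w ≡ F v → w ≡ G lower ⊎ w ≡ G upper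
  lifted-exhaustive w fw w-prefix with G-onto w fw w-prefix
  ... | x , fx , refl with exhaustive x fx (F-injective (take ℓ₁ x) (Factor-take ℓ₁ _ x ℓ₁≤ℓ₂ fx)
                                                         (trans (sym (G-prefix x)) w-prefix))
  ...   | inj₁ refl = inj₁ refl
  ...   | inj₂ refl = inj₂ refl

two≤length : ∀ {n w} → Factor (suc (suc n)) w → 2 ≤ length w
two≤length (len , _) = subst (2 ≤_) (sym len) (s≤s (s≤s z≤n))

lift-Θ₀ : ∀ n v → let N = suc (suc n) in Factor (suc N) v →
          Extensions (suc N) (suc (2 * N)) v → Extensions (suc (2 * N)) (suc (2 * (2 * N))) (Θ₀ N v)
lift-Θ₀ n v fv = extensions-lift (Θ₀ N) (Θ₀ (2 * N)) (s≤s (N≤2N N))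
  (λ x → take-Θ₀ N (2 * N) x (N≤2N N))
  (λ x fx → Θ₀-injective N x v (proj₁ fx) (proj₁ fv))
  (Factor-Θ₀ (2 * N))
  (λ a b fa fb _ → Θ₀-mono (2 * N) (proj₁ fa) (proj₁ fb))
  Θ₀-onto
  where
  N : ℕ
  N = suc (suc n)
  Θ₀-onto : ∀ w → Factor (suc (2 * (2 * N))) w → take (suc (2 * N)) w ≡ Θ₀ N v →
            Σ Word λ x → Factor (suc (2 * N)) x × w ≡ Θ₀ (2 * N) x
  Θ₀-onto w fw w-prefix with desubstitute (2 * N) w (s≤s z≤n) fw
  ... | x , fx , inj₁ refl = x , fx , refl
  ... | x , fx , inj₂ refl = ⊥-elim (no-collision n v (take (suc N) x) (two≤length fv)
                                       (IsFactor-take (suc N) x (proj₂ fx)) (trans (Θ₁-take N x) w-prefix))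

lift-Θ₁ : ∀ n v → let N = suc (suc n) in Factor (suc N) v →
          Extensions (suc N) (suc (2 * N)) v → Extensions (suc (2 * N)) (suc (2 * (2 * N))) (Θ₁ v)
lift-Θ₁ n v fv = extensions-lift Θ₁ Θ₁ (s≤s (N≤2N N))
  (λ x → sym (Θ₁-take N x))
  (λ x _ → Θ₁-injective x v)
  (Factor-Θ₁ (2 * N))
  (λ a b _ _ same-prefix → Θ₁-mono (take-agree-≤ 1 (suc N) a b (s≤s z≤n) same-prefix))
  Θ₁-onto
  where
  N : ℕ
  N = suc (suc n)
  Θ₁-onto : ∀ w → Factor (suc (2 * (2 * N))) w → take (suc (2 * N)) w ≡ Θ₁ v →
            Σ Word λ x → Factor (suc (2 * N)) x × w ≡ Θ₁ x
  Θ₁-onto w fw w-prefix with desubstitute (2 * N) w (s≤s z≤n) fw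
  ... | x , fx , inj₂ refl = x , fx , refl
  ... | x , fx , inj₁ refl = ⊥-elim (no-collision n (take (suc N) x) v
                                       (two≤length (Factor-take (suc N) _ x (s≤s (N≤2N N)) fx)) (proj₂ fv)
                                       (sym (trans (sym (take-Θ₀ N (2 * N) x (N≤2N N))) w-prefix)))

double-step : ∀ N → 2 ≤ N → TwoExtensions (suc N) (suc (2 * N)) →
              TwoExtensions (suc (2 * N)) (suc (2 * (2 * N)))
double-step (suc zero)    (s≤s ())
double-step (suc (suc n)) _ ih u fu with desubstitute (suc (suc n)) u (s≤s z≤n) fu
... | v , fv , inj₁ refl = lift-Θ₀ n v fv (ih v fv)
... | v , fv , inj₂ refl = lift-Θ₁ n v fv (ih v fv)

two-extensions : ∀ m → TwoExtensions (suc (2 ^ suc m)) (suc (2 ^ suc (suc m)))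
two-extensions zero    = two-extensions-3-5
two-extensions (suc m) = double-step (2 ^ suc m) (*-monoʳ-≤ 2 (m^n>0 2 m)) (two-extensions m)

module _ {A : Set} {_<_ : A → A → Set} (<-irrefl : ∀ {x} → ¬ x < x) (<-trans : Transitive _<_) where

  private
    below : ∀ {x xs w} → Linked _<_ (x ∷ xs) → w ∈ xs → x < w
    below sorted = All.lookup (AllPairs.head (Linked⇒AllPairs <-trans sorted))

  sorted-unique : ∀ {xs ys} → Linked _<_ xs → Linked _<_ ys →
                  (∀ {w} → w ∈ xs → w ∈ ys) → (∀ {w} → w ∈ ys → w ∈ xs) → xs ≡ ys
  sorted-unique {[]}     {[]}     _  _  _   _   = refl
  sorted-unique {[]}     {y ∷ ys} _  _  _   ys⊆ with ys⊆ (here refl)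
  ... | ()
  sorted-unique {x ∷ xs} {[]}     _  _  xs⊆ _   with xs⊆ (here refl)
  ... | ()
  sorted-unique {x ∷ xs} {y ∷ ys} s₁ s₂ xs⊆ ys⊆ =
    cong₂ _∷_ x≡y (sorted-unique (Linked.tail s₁) (Linked.tail s₂) xs⊆′ ys⊆′)
    where
    -- The heads are the least elements of the same set.
    x≡y : x ≡ y
    x≡y with xs⊆ (here refl) | ys⊆ (here refl)
    ... | here x≡y   | _          = x≡y
    ... | there _    | here y≡x   = sym y≡x
    ... | there x∈ys | there y∈xs = ⊥-elim (<-irrefl (<-trans (below s₂ x∈ys) (below s₁ y∈xs)))
    xs⊆′ : ∀ {w} → w ∈ xs → w ∈ ys
    xs⊆′ {w} w∈xs with xs⊆ (there w∈xs)
    ... | here w≡y   = ⊥-elim (<-irrefl (subst (x <_) (trans w≡y (sym x≡y)) (below s₁ w∈xs)))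
    ... | there w∈ys = w∈ys
    ys⊆′ : ∀ {w} → w ∈ ys → w ∈ xs
    ys⊆′ {w} w∈ys with ys⊆ (there w∈ys)
    ... | here w≡x   = ⊥-elim (<-irrefl (subst (y <_) (trans w≡x x≡y) (below s₂ w∈ys)))
    ... | there w∈xs = w∈xs

module Refinement {ℓ ℓ′ : ℕ} where

  open Extensions

  refine : (L : List Word) → All (Extensions ℓ ℓ′) L → List Word
  refine []      []       = []
  refine (u ∷ L) (e ∷ es) = lower e ∷ upper e ∷ refine L es

  -- Extensions of u < u′ are compared through their prefixes u and u′.
  refine-sorted : ∀ {L} → Linked _<ₗ_ L → (es : All (Extensions ℓ ℓ′) L) → Linked _<ₗ_ (refine L es)
  refine-sorted []              []                = []
  refine-sorted [-]             (e ∷ [])          = lower<upper e ∷ [-]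
  refine-sorted (u<u′ ∷ sorted) (e ∷ es@(e′ ∷ _)) =
    lower<upper e ∷ <ₗ-from-prefix ℓ (upper e) (lower e′)
                      (subst₂ _<ₗ_ (sym (upper-prefix e)) (sym (lower-prefix e′)) u<u′)
                  ∷ refine-sorted sorted es

  refine-sound : ∀ {L} (es : All (Extensions ℓ ℓ′) L) {w} → w ∈ refine L es → Factor ℓ′ w
  refine-sound (e ∷ es) (here refl)         = lower-factor e
  refine-sound (e ∷ es) (there (here refl)) = upper-factor e
  refine-sound (e ∷ es) (there (there w∈))  = refine-sound es w∈

  refine-complete : ∀ {L u} (es : All (Extensions ℓ ℓ′) L) → u ∈ L →
                    ∀ w → Factor ℓ′ w → take ℓ w ≡ u → w ∈ refine L es
  refine-complete (e ∷ es) (here refl) w fw w-prefix with exhaustive e w fw w-prefix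
  ... | inj₁ refl = here refl
  ... | inj₂ refl = there (here refl)
  refine-complete (e ∷ es) (there u∈) w fw w-prefix = there (there (refine-complete es u∈ w fw w-prefix))

  -- Entries 2i and 2i+1 of the refinement extend entry i (both sides are
  -- nothing when i is out of range).
  refine-nth : ∀ L (es : All (Extensions ℓ ℓ′) L) i →
               map (take ℓ) (nth (refine L es) (2 * i)) ≡ nth L i ×
               map (take ℓ) (nth (refine L es) (2 * i + 1)) ≡ nth L i
  refine-nth []      []       i       = refl , refl
  refine-nth (u ∷ L) (e ∷ es) zero    = cong just (lower-prefix e) , cong just (upper-prefix e)
  refine-nth (u ∷ L) (e ∷ es) (suc i) =
    trans (at-double-suc (λ k → map (take ℓ) (nth R k)) i) (proj₁ (refine-nth L es i)) ,
    trans (at-double-suc (λ k → map (take ℓ) (nth R (k + 1))) i) (proj₂ (refine-nth L es i))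
    where
    R : List Word
    R = lower e ∷ upper e ∷ refine L es

  refinement : ℓ ≤ ℓ′ → TwoExtensions ℓ ℓ′ → (L L′ : List Word) →
    Linked _<ₗ_ L  → (∀ w → (w ∈ L) ⇔ Factor ℓ w) →
    Linked _<ₗ_ L′ → (∀ w → (w ∈ L′) ⇔ Factor ℓ′ w) →
    Σ (All (Extensions ℓ ℓ′) L) λ es → refine L es ≡ L′
  refinement ℓ≤ℓ′ two L L′ sorted enum sorted′ enum′ = es , sorted-unique <ₗ-irrefl <ₗ-trans
      (refine-sorted sorted es) sorted′
      (λ {w} w∈ → Equivalence.from (enum′ w) (refine-sound es w∈))
      (λ {w} w∈ → let fw = Equivalence.to (enum′ w) w∈ in
         refine-complete es (Equivalence.from (enum (take ℓ w)) (Factor-take ℓ ℓ′ w ℓ≤ℓ′ fw)) w fw refl)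
    where
    es : All (Extensions ℓ ℓ′) L
    es = All.tabulate (λ {u} u∈L → two u (Equivalence.to (enum u) u∈L))

open Refinement

lemma5 : (m : ℕ) → 1 ≤ m → (L L′ : List Word) → Enumerates m L → Enumerates (suc m) L′ →
    (i : ℕ) → i < length L →
    (map (take (2 ^ m + 1)) (nth L′ (2 * i)) ≡ nth L i)
    × (map (take (2 ^ m + 1)) (nth L′ (2 * i + 1)) ≡ nth L i)
lemma5 (suc m) _ L L′ (sorted , enum) (sorted′ , enum′) i _
  with refinement ℓ≤ℓ′ extensions L L′ sorted enum sorted′ enum′
  where
  ℓ≤ℓ′ : 2 ^ suc m + 1 ≤ 2 ^ suc (suc m) + 1
  ℓ≤ℓ′ = +-monoˡ-≤ 1 (N≤2N (2 ^ suc m))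
  extensions : TwoExtensions (2 ^ suc m + 1) (2 ^ suc (suc m) + 1)
  extensions = subst₂ TwoExtensions (+-comm 1 (2 ^ suc m)) (+-comm 1 (2 ^ suc (suc m))) (two-extensions m)
... | es , refl = refine-nth L es i
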